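{- For all $\Gamma\subseteq For$ and $\alpha,\beta\in For$: if $\Gamma\cup\{\alpha\}\vDash^{\mathbb{P}}_{L_3}\beta$, then $\Gamma\vDash^{\mathbb{P}}_{L_3}\alpha\rightarrow(\alpha\rightarrow\beta)$.
   Context: $For$ is the set of formulas built from a countable set $Prop$ of propositional letters with $\neg,\vee,\wedge,\rightarrow$. $L_3$ (Łukasiewicz) is given by the matrix with truth values $\{0,1/2,1\}$, designated set $\{1\}$, $f_\neg(x)=1-x$, $f_\vee=\max$, $f_\wedge=\min$, $f_\rightarrow(x,y)=\min\{1,1-x+y\}$; valuations are maps $Prop\to\{0,1/2,1\}$ extended via these functions. $\Gamma\vDash_{L_3}\alpha$ iff every valuation giving all members of $\Gamma$ value $1$ gives $\alpha$ value $1$; $\Gamma$ is $L_3$-consistent iff $\{\alpha:\Gamma\vDash_{L_3}\alpha\}\neq For$. $\Gamma\vDash^{\mathbb{P}}_{L_3}\alpha$ iff there exists an $L_3$-consistent $\Gamma'\subseteq\Gamma$ with $\Gamma'\vDash_{L_3}\alpha$. -}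

module Defs where

open import Data.Nat using (ℕ)
open import Data.Product using (Σ; _×_)
open import Data.Sum using (_⊎_)
open import Relation.Nullary using (¬_)
open import Relation.Binary.PropositionalEquality using (_≡_)

Prop : Set
Prop = ℕ

data For : Set where
  var  : Prop → For
  ¬′_  : For → For
  _∨′_ : For → For → For
  _∧′_ : For → For → For
  _⇒_  : For → For → For

infixr 5 _⇒_

-- Truth values {0, 1/2, 1} of L3.
data V : Set where
  v0 vh v1 : V

f¬ : V → V
f¬ v0 = v1
f¬ vh = vh
f¬ v1 = v0

f∨ : V → V → V
f∨ v1 _  = v1
f∨ _  v1 = v1
f∨ vh _  = vh
f∨ _  vh = vh
f∨ v0 v0 = v0

f∧ : V → V → V
f∧ v0 _  = v0
f∧ _  v0 = v0
f∧ vh _  = vh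
f∧ _  vh = vh
f∧ v1 v1 = v1

f→ : V → V → V      -- min{1, 1 - x + y}
f→ v0 _  = v1
f→ vh v0 = vh
f→ vh vh = v1
f→ vh v1 = v1
f→ v1 y  = y

Valuation : Set
Valuation = Prop → V

⟦_⟧ : For → Valuation → V
⟦ var p ⟧ v = v p
⟦ ¬′ a ⟧ v = f¬ (⟦ a ⟧ v)
⟦ a ∨′ b ⟧ v = f∨ (⟦ a ⟧ v) (⟦ b ⟧ v)
⟦ a ∧′ b ⟧ v = f∧ (⟦ a ⟧ v) (⟦ b ⟧ v)
⟦ a ⇒ b ⟧ v = f→ (⟦ a ⟧ v) (⟦ b ⟧ v)

FSet : Set₁
FSet = For → Set

_⊆_ : FSet → FSet → Set
Γ ⊆ Δ = ∀ φ → Γ φ → Δ φ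

_,,_ : FSet → For → FSet
(Γ ,, α) φ = Γ φ ⊎ φ ≡ α

_⊨_ : FSet → For → Set
Γ ⊨ α = ∀ (v : Valuation) → (∀ φ → Γ φ → ⟦ φ ⟧ v ≡ v1) → ⟦ α ⟧ v ≡ v1

Consistent : FSet → Set
Consistent Γ = Σ For (λ φ → ¬ (Γ ⊨ φ))

_⊨ᴾ_ : FSet → For → Set₁
Γ ⊨ᴾ α = Σ FSet (λ Γ′ → (Γ′ ⊆ Γ) × Consistent Γ′ × (Γ′ ⊨ α))

module Submission where

open import Defs
open import Data.Product using (_,_; proj₁; proj₂)
open import Data.Sum using (inj₁; inj₂)
open import Relation.Binary.PropositionalEquality using (_≡_; refl)
open import Relation.Unary using (_∩_)

-- Keep the part of Γ′ lying in Γ: it is consistent because Γ′ is, and adding α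
-- back recovers all of Γ′; the deduction theorem for α ⇒ (α ⇒ _) does the rest.

⊨-mono : ∀ {Δ Γ φ} → Δ ⊆ Γ → Δ ⊨ φ → Γ ⊨ φ
⊨-mono Δ⊆Γ Δ⊨φ v Γ-true = Δ⊨φ v (λ ψ ψ∈Δ → Γ-true ψ (Δ⊆Γ ψ ψ∈Δ))

Consistent-antitone : ∀ {Δ Γ} → Δ ⊆ Γ → Consistent Γ → Consistent Δ
Consistent-antitone Δ⊆Γ (φ , Γ⊭φ) = φ , λ Δ⊨φ → Γ⊭φ (⊨-mono {φ = φ} Δ⊆Γ Δ⊨φ)

∩-⊆ˡ : (Δ Γ : FSet) → (Δ ∩ Γ) ⊆ Δ
∩-⊆ˡ Δ Γ ψ = proj₁

∩-⊆ʳ : (Δ Γ : FSet) → (Δ ∩ Γ) ⊆ Γ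
∩-⊆ʳ Δ Γ ψ = proj₂

⊆,,⇒⊆∩,, : ∀ {Δ Γ α} → Δ ⊆ (Γ ,, α) → Δ ⊆ ((Δ ∩ Γ) ,, α)
⊆,,⇒⊆∩,, Δ⊆Γα ψ ψ∈Δ with Δ⊆Γα ψ ψ∈Δ
... | inj₁ ψ∈Γ = inj₁ (ψ∈Δ , ψ∈Γ)
... | inj₂ ψ≡α = inj₂ ψ≡α

-- With a single antecedent the deduction theorem fails at value 1/2
-- (f→ vh v0 = vh); doubling the antecedent absorbs it.
f→-twice-designated : ∀ x y → (x ≡ v1 → y ≡ v1) → f→ x (f→ x y) ≡ v1
f→-twice-designated v0 y  x⇒y = refl
f→-twice-designated vh v0 x⇒y = refl
f→-twice-designated vh vh x⇒y = refl
f→-twice-designated vh v1 x⇒y = refl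
f→-twice-designated v1 y  x⇒y = x⇒y refl

⊨-deduction² : ∀ {Γ α β} → (Γ ,, α) ⊨ β → Γ ⊨ (α ⇒ (α ⇒ β))
⊨-deduction² {α = α} {β} Γα⊨β v Γ-true =
  f→-twice-designated (⟦ α ⟧ v) (⟦ β ⟧ v) λ α-true → Γα⊨β v λ where
    ψ (inj₁ ψ∈Γ) → Γ-true ψ ψ∈Γ
    ψ (inj₂ refl) → α-true

proposition13 : (Γ : FSet) (α β : For) → (Γ ,, α) ⊨ᴾ β → Γ ⊨ᴾ (α ⇒ (α ⇒ β))
proposition13 Γ α β (Γ′ , Γ′⊆Γα , Γ′-consistent , Γ′⊨β) =
  Γ′ ∩ Γ ,
  ∩-⊆ʳ Γ′ Γ ,
  Consistent-antitone (∩-⊆ˡ Γ′ Γ) Γ′-consistent ,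
  ⊨-deduction² {β = β} (⊨-mono {φ = β} (⊆,,⇒⊆∩,, Γ′⊆Γα) Γ′⊨β)
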